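{- Let $u\in A^*$ be such that $w(N(u,A)\setminus\{n(u)\})\leq\epsilon\,w(u)$ and $(1+\epsilon)w(u)<w(n(u))$. Then \[\Big(\sum_{v\in A}\mathrm{contr}(u,v)-2\,\mathrm{charge}(u,n(u))\Big)w(n(u))\geq 2\xi\, w(n(u))\, w(\mathrm{supp}(u)).\]
   Context: Let $k\geq 4$ be an integer and $G=(V,E)$ a finite simple $(k+1)$-claw free graph (no vertex has $k+1$ pairwise non-adjacent neighbors) with weights $w:V\to\mathbb{Q}_{>0}$; $w(X)=\sum_{x\in X}w(x)$, $w^2(X)=\sum_{x\in X}w(x)^2$. Let $A^*$ be a maximum-weight independent set and $A$ an independent set. $N(X,A)=(X\cap A)\cup\{a\in A: a\text{ adjacent to some }x\in X\}$, $N(u,A)=N(\{u\},A)$. An independent $X$ is a local improvement if $w^2(X)>w^2(N(X,A))$; it is claw-shaped if $|X|=1$ and $N(X,A)=\emptyset$, or some $v\in A$ is adjacent to all of $X$. Assume no claw-shaped improvement of $A$ exists (so $A$ is maximal). Fix $n(u)\in N(u,A)$ of maximum weight and, if $|N(u,A)|\geq2$, $n_2(u)\in N(u,A)\setminus\{n(u)\}$ of maximum weight. $\mathrm{contr}(u,v)=\max\{0,(w(u)^2-w^2(N(u,A)\setminus\{v\}))/w(v)\}$ if $v\in N(u,A)$, else $0$; $\mathrm{charge}(u,v)=w(u)-\frac12w(N(u,A))$ if $v=n(u)$, else $0$. Constants $\epsilon,\xi>0$ satisfy: $\frac38(1+\epsilon)^2+\epsilon^2\leq\frac{11}{16}(1+\epsilon)^2+\epsilon^2\leq\frac34(1+\epsilon)^2+\epsilon^2\leq1$;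 $\frac{1-\epsilon}{2}\geq\frac{1-\epsilon(1+\epsilon)}{2}\geq\frac{1-2\epsilon(1+\epsilon)}{2}\geq\xi$; $\big(1-\sqrt{\tfrac{5}{8(1-\epsilon^2)}}\big)^2/\big(1+\epsilon\sqrt{\tfrac{5}{8(1-\epsilon^2)}}\big)\geq 2\xi$; $\min\{\frac{\epsilon}{2+\epsilon},\frac14,\frac1{4(1+\epsilon)},\frac{\epsilon}{2(1+\epsilon)},\frac{\epsilon}{4+2\epsilon}\}\geq\frac{\epsilon}{4(2+\epsilon)}\geq\xi$; $\frac{\epsilon}{2(1+\epsilon)(2+\epsilon)}\geq\frac{\epsilon}{2(1+\epsilon)^2(2+\epsilon)}\geq\frac{\epsilon}{2(1+\epsilon)^3(2+\epsilon)}\geq\xi$; $\frac{(1/3-\epsilon)^2}{(4/3+2\epsilon)(2+\epsilon)}\geq\xi$; $\epsilon\big(\frac{2+(1+\epsilon)^{ -1}}{2+\epsilon}-(1+\epsilon)\big)\geq2\xi$. Helpful: $u\in N(v,V\setminus A)$ is helpful for $v\in A$ if either (a) $v=n(u)$, $w(n(u))\leq(1+\epsilon)w(u)$ and $w(N(u,A)\setminus\{n(u)\})\leq\epsilon w(u)$; or (b) $|N(u,A)|\geq2$, $v\in\{n(u),n_2(u)\}$, $(1+\epsilon)^{ -1}w(n(u))\leq w(n_2(u))\leq w(n(u))\leq(1+\epsilon)w(u)$ and $w(N(u,A)\setminus\{n(u),n_2(u)\})\leq\epsilon w(u)$. $\mathrm{help}(u)$ is the set of $v\in A$ that $u$ is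 helpful for. $u\in A^*$ and $v\in A$ are special neighbors if $v=n(u)$, $v\notin\mathrm{help}(u)$ and $\mathrm{contr}(u,v)>\frac58w(v)$. For $u\in A^*$, $\mathrm{supp}(u)=\{v\in N(u,A)\setminus\mathrm{help}(u): u\text{ and }v\text{ are not special neighbors}\}$. -}

module Defs where

open import Data.Bool using (Bool; true; false; _∧_; _∨_; not; if_then_else_)
open import Data.Nat as ℕ using (ℕ; suc)
open import Data.Fin using (Fin)
open import Data.Fin.Properties using () renaming (_≟_ to _≟ᶠ_)
open import Data.List using (List; foldr; map; sum)
open import Data.List.Base using (allFin)
open import Data.Integer using (+_)
open import Data.Rational
  using (ℚ; 0ℚ; 1ℚ; ½; _+_; _*_; _-_; _÷_; _≤_; _<_; _⊔_; _⊓_; _/_; _≤ᵇ_; ≢-nonZero)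
open import Data.Rational.Properties using (_≟_)
open import Data.Product using (_×_)
open import Relation.Nullary using (¬_; yes; no)
open import Relation.Nullary.Decidable using (⌊_⌋)
open import Relation.Binary.PropositionalEquality using (_≡_; _≢_)
open import Function.Definitions using (Injective)

Sub : ℕ → Set
Sub n = Fin n → Bool

_∈ˢ_ : ∀ {n} → Fin n → Sub n → Set
x ∈ˢ S = S x ≡ true

∑ : ∀ {n} → (Fin n → ℚ) → ℚ
∑ {n} f = foldr (λ i acc → f i + acc) 0ℚ (allFin n)

anyV : ∀ {n} → (Fin n → Bool) → Bool
anyV {n} p = foldr (λ i acc → p i ∨ acc) false (allFin n)

card : ∀ {n} → Sub n → ℕ
card {n} S = foldr (λ i acc → if S i then suc acc else acc) 0 (allFin n)

_==_ : ∀ {n} → Fin n → Fin n → Bool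
i == j = ⌊ i ≟ᶠ j ⌋

-- division p / q, used only with q > 0 (weights are positive); 0 if q = 0
infixl 7 _÷'_
infix 8 _²

_÷'_ : ℚ → ℚ → ℚ
p ÷' q with q ≟ 0ℚ
... | yes _ = 0ℚ
... | no q≢0 = _÷_ p q {{≢-nonZero q≢0}}

_² : ℚ → ℚ
x ² = x * x

record SimpleGraph (n : ℕ) : Set where
  field
    adj   : Fin n → Fin n → Bool
    sym   : ∀ i j → adj i j ≡ adj j i
    irrefl : ∀ i → adj i i ≡ false

-- (k+1)-claw free: no vertex has k+1 pairwise non-adjacent (distinct) neighbours
ClawFree : ∀ {n} → ℕ → SimpleGraph n → Set
ClawFree {n} k G = ∀ (v : Fin n) (f : Fin (suc k) → Fin n) → Injective _≡_ _≡_ f →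
  (∀ i → adj v (f i) ≡ true) →
  (∀ i j → i ≢ j → adj (f i) (f j) ≡ false) → Data.Empty.⊥
  where open SimpleGraph G
        import Data.Empty

module Graph {n : ℕ} (G : SimpleGraph n) (w : Fin n → ℚ) where
  open SimpleGraph G

  Independent : Sub n → Set
  Independent S = ∀ i j → i ∈ˢ S → j ∈ˢ S → adj i j ≡ false

  wt : Sub n → ℚ
  wt S = ∑ (λ i → if S i then w i else 0ℚ)

  wt² : Sub n → ℚ
  wt² S = ∑ (λ i → if S i then (w i) ² else 0ℚ)

  MaxWeightIndependent : Sub n → Set
  MaxWeightIndependent S = Independent S × (∀ T → Independent T → wt T ≤ wt S)

  N : Sub n → Sub n → Sub n
  N X A a = A a ∧ (X a ∨ anyV (λ x → X x ∧ adj a x))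

  singleton : Fin n → Sub n
  singleton u v = v == u

  Nv : Fin n → Sub n → Sub n
  Nv u A = N (singleton u) A

  _∖₁_ : Sub n → Fin n → Sub n
  (S ∖₁ v) x = S x ∧ not (x == v)

  complement : Sub n → Sub n
  complement S x = not (S x)

  IsLocalImprovement : Sub n → Sub n → Set
  IsLocalImprovement A X = Independent X × (wt² (N X A) < wt² X)

  ClawShaped : Sub n → Sub n → Set
  ClawShaped A X =
      (card X ≡ 1 × (∀ a → N X A a ≡ false))
    Data.Sum.⊎ Data.Product.Σ (Fin n) (λ v → v ∈ˢ A × (∀ x → x ∈ˢ X → adj v x ≡ true))
    where import Data.Sum
          import Data.Product

  NoClawShapedImprovement : Sub n → Set
  NoClawShapedImprovement A = ∀ X → ClawShaped A X → ¬ IsLocalImprovement A X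

  IsMaxNbr : Sub n → (Fin n → Fin n) → Set
  IsMaxNbr A nf = ∀ u → anyV (Nv u A) ≡ true →
    nf u ∈ˢ Nv u A × (∀ a → a ∈ˢ Nv u A → w a ≤ w (nf u))

  IsSecondMaxNbr : Sub n → (Fin n → Fin n) → (Fin n → Fin n) → Set
  IsSecondMaxNbr A nf nf₂ = ∀ u → 2 ℕ.≤ card (Nv u A) →
    nf₂ u ∈ˢ (Nv u A ∖₁ nf u) × (∀ a → a ∈ˢ (Nv u A ∖₁ nf u) → w a ≤ w (nf₂ u))

  module Charging (A : Sub n) (nf nf₂ : Fin n → Fin n) (ε : ℚ) where

    contr : Fin n → Fin n → ℚ
    contr u v = if Nv u A v
                then 0ℚ ⊔ (((w u) ² - wt² (Nv u A ∖₁ v)) ÷' w v)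
                else 0ℚ

    charge : Fin n → Fin n → ℚ
    charge u v = if v == nf u then w u - ½ * wt (Nv u A) else 0ℚ

    sumContr : Fin n → ℚ
    sumContr u = ∑ (λ v → if A v then contr u v else 0ℚ)

    inNbrOutside : Fin n → Fin n → Bool
    inNbrOutside u v = Nv v (complement A) u

    helpfulA : Fin n → Fin n → Bool
    helpfulA u v = (v == nf u)
                 ∧ (w (nf u) ≤ᵇ (1ℚ + ε) * w u)
                 ∧ (wt (Nv u A ∖₁ nf u) ≤ᵇ ε * w u)

    helpfulB : Fin n → Fin n → Bool
    helpfulB u v = ⌊ 2 ℕ.≤? card (Nv u A) ⌋
                 ∧ ((v == nf u) ∨ (v == nf₂ u))
                 ∧ (w (nf u) ÷' (1ℚ + ε) ≤ᵇ w (nf₂ u))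
                 ∧ (w (nf₂ u) ≤ᵇ w (nf u))
                 ∧ (w (nf u) ≤ᵇ (1ℚ + ε) * w u)
                 ∧ (wt ((Nv u A ∖₁ nf u) ∖₁ nf₂ u) ≤ᵇ ε * w u)

    helpful : Fin n → Fin n → Bool
    helpful u v = A v ∧ inNbrOutside u v ∧ (helpfulA u v ∨ helpfulB u v)

    help : Fin n → Sub n
    help u v = helpful u v

    special : Fin n → Fin n → Bool
    special u v = (v == nf u) ∧ not (help u v)
                ∧ not (contr u v ≤ᵇ (+ 5 / 8) * w v)

    supp : Fin n → Sub n
    supp u v = Nv u A v ∧ not (help u v) ∧ not (special u v)

-- The standing constraints on the constants ε, ξ.
-- c = 5 / (8 (1 - ε²)) is the radicand; the condition
--   (1 - √c)² / (1 + ε √c) ≥ 2ξ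
-- is stated in the equivalent radical-free form:
--   1 + c - 2ξ ≥ 0  and  (1 + c - 2ξ)² ≥ (2 + 2ξε)² c.
record Constants (ε ξ : ℚ) : Set where
  private
    e1 = 1ℚ + ε
    two = + 2 / 1
    four = + 4 / 1
    c = (+ 5 / 8) ÷' (1ℚ - ε * ε)
  field
    ε-pos : 0ℚ < ε
    ξ-pos : 0ℚ < ξ
    c1 : (+ 3 / 8) * e1 ² + ε ² ≤ (+ 11 / 16) * e1 ² + ε ²
    c2 : (+ 11 / 16) * e1 ² + ε ² ≤ (+ 3 / 4) * e1 ² + ε ²
    c3 : (+ 3 / 4) * e1 ² + ε ² ≤ 1ℚ
    c4 : (1ℚ - ε * e1) ÷' two ≤ (1ℚ - ε) ÷' two
    c5 : (1ℚ - two * ε * e1) ÷' two ≤ (1ℚ - ε * e1) ÷' two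
    c6 : ξ ≤ (1ℚ - two * ε * e1) ÷' two
    radicand-pos : 0ℚ < 1ℚ - ε * ε
    c7a : 0ℚ ≤ 1ℚ + c - two * ξ
    c7b : (two + two * ξ * ε) ² * c ≤ (1ℚ + c - two * ξ) ²
    c8 : ε ÷' (four * (two + ε))
         ≤ (ε ÷' (two + ε)) ⊓ (+ 1 / 4) ⊓ (1ℚ ÷' (four * e1))
             ⊓ (ε ÷' (two * e1)) ⊓ (ε ÷' (four + two * ε))
    c9 : ξ ≤ ε ÷' (four * (two + ε))
    c10 : ε ÷' (two * e1 * e1 * (two + ε)) ≤ ε ÷' (two * e1 * (two + ε))
    c10' : ε ÷' (two * e1 * e1 * e1 * (two + ε)) ≤ ε ÷' (two * e1 * e1 * (two + ε))
    c11 : ξ ≤ ε ÷' (two * e1 * e1 * e1 * (two + ε))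
    c12 : ξ ≤ ((+ 1 / 3) - ε) ² ÷' (((+ 4 / 3) + two * ε) * (two + ε))
    c13 : two * ξ ≤ ε * (((two + (1ℚ ÷' e1)) ÷' (two + ε)) - e1)

module Submission where

-- Write U = w(u), W = w(n(u)), and r, s for the weight and the squared weight of
-- N(u,A) ∖ {n(u)}. As W > (1+ε)U, u is helpful for no vertex. Its contribution to n(u)
-- satisfies contr(u,n(u))·W ≥ U² − s ≥ U² − r², so (Σ contr − 2 charge)·W ≥ (W − U)² + r(W − r).
-- If u and n(u) are special neighbours, then n(u) ∉ supp(u), so w(supp u) ≤ r, and
-- 2ξWr ≤ r(W − r) because r ≤ εW and ε + 2ξ ≤ 1. Otherwise contr(u,n(u)) ≤ 5/8·W, which together
-- with s ≤ ε²U² gives U² ≤ cW² for c = 5/(8(1 − ε²)); the constraint on ξ then yields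
-- (W − U)² ≥ 2ξW², while w(supp u) ≤ W + r.

open import Defs
open import Data.Nat using (ℕ; _≤_)
open import Data.Fin using (Fin)
open import Data.Integer using (+_)
open import Data.Rational using (ℚ; 0ℚ; 1ℚ; _+_; _*_; _-_; _<_; _/_) renaming (_≤_ to _≤ℚ_)

import Data.Nat as ℕ
open import Data.Fin using (zero; suc)
open import Data.Fin.Properties using (suc-injective) renaming (_≟_ to _≟ᶠ_)
open import Data.Bool using (Bool; true; false; _∧_; _∨_; not; if_then_else_)
open import Data.Bool.Properties
  using (T-≡; ∧-conicalˡ; ∧-conicalʳ; ∨-conicalˡ; ∨-conicalʳ; ∧-identityʳ; ¬-not; not-injective)
open import Data.List using (foldr; map; tabulate; allFin)
open import Data.List.Properties using (foldr-map; map-tabulate)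
open import Data.Product using (_,_; proj₁)
open import Data.Sum using (_⊎_; inj₁; inj₂)
open import Data.Empty using (⊥-elim)
open import Data.Rational using (-_; ½; 1/_; _⊔_; _≤ᵇ_; positive; nonNegative; nonPositive; ≢-nonZero)
open import Data.Rational.Properties
open import Data.Rational.Solver using (module +-*-Solver)
import Algebra.Properties.CommutativeMonoid.Sum +-0-commutativeMonoid as Σ
open import Function using (_∘_; _$_; id; case_of_)
open import Function.Bundles using (Equivalence)
open import Relation.Binary.PropositionalEquality
open import Relation.Nullary using (yes; no)
open import Relation.Nullary.Decidable using (⌊_⌋; ⌊⌋-map′; isYes≗does; dec-true; dec-false; toWitness)

open Σ using (sum)
open +-*-Solver

private
  two four : ℚ
  two = + 2 / 1
  four = + 4 / 1

  variable
    p q d : ℚ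

+-nonNeg : 0ℚ ≤ℚ p → 0ℚ ≤ℚ q → 0ℚ ≤ℚ p + q
+-nonNeg = +-mono-≤

*-nonNeg : 0ℚ ≤ℚ p → 0ℚ ≤ℚ q → 0ℚ ≤ℚ p * q
*-nonNeg {p} 0≤p 0≤q = subst (_≤ℚ p * _) (*-zeroʳ p) (*-monoˡ-≤-nonNeg p {{nonNegative 0≤p}} 0≤q)

p≤q⇒0≤q-p : p ≤ℚ q → 0ℚ ≤ℚ q - p
p≤q⇒0≤q-p {p} {q} p≤q = subst (_≤ℚ q - p) (+-inverseʳ p) (+-monoˡ-≤ (- p) p≤q)

≤-by-gap : 0ℚ ≤ℚ d → p + d ≡ q → p ≤ℚ q
≤-by-gap {p = p} 0≤d eq = subst₂ _≤ℚ_ (+-identityʳ p) eq (+-monoʳ-≤ p 0≤d)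

≤ᵇ-true⇒≤ : (p ≤ᵇ q) ≡ true → p ≤ℚ q
≤ᵇ-true⇒≤ = ≤ᵇ⇒≤ ∘ Equivalence.from T-≡

≤-from-squares : 0ℚ ≤ℚ q → p * p ≤ℚ q * q → p ≤ℚ q
≤-from-squares {q} {p} 0≤q p²≤q² = ≮⇒≥ λ q<p → <-irrefl refl (<-≤-trans (q²<p² q<p) p²≤q²)
  where
  q²<p² : q < p → q * q < p * p
  q²<p² q<p = ≤-<-trans (*-monoʳ-≤-nonNeg q {{nonNegative 0≤q}} (<⇒≤ q<p))
                        (*-monoʳ-<-pos p {{positive (≤-<-trans 0≤q q<p)}} q<p)

square-nonNeg : ∀ p → 0ℚ ≤ℚ p * p
square-nonNeg p with ≤-total 0ℚ p
... | inj₁ 0≤p = *-nonNeg 0≤p 0≤p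
... | inj₂ p≤0 = nonNegative⁻¹ (p * p) {{nonPos*nonPos⇒nonPos p {{nonPositive p≤0}} p {{nonPositive p≤0}}}}

square-mono : 0ℚ ≤ℚ p → p ≤ℚ q → p * p ≤ℚ q * q
square-mono {p} {q} 0≤p p≤q = ≤-trans (*-monoˡ-≤-nonNeg p {{nonNegative 0≤p}} p≤q)
                                      (*-monoʳ-≤-nonNeg q {{nonNegative (≤-trans 0≤p p≤q)}} p≤q)

÷'-*-cancel : 0ℚ < q → (p ÷' q) * q ≡ p
÷'-*-cancel {q} {p} 0<q with q ≟ 0ℚ
... | yes q≡0 = ⊥-elim (<⇒≢ 0<q (sym q≡0))
... | no q≢0 = begin
  p * 1/ q * q    ≡⟨ *-assoc p (1/ q) q ⟩
  p * (1/ q * q)  ≡⟨ cong (p *_) (*-inverseˡ q) ⟩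
  p * 1ℚ          ≡⟨ *-identityʳ p ⟩
  p               ∎
  where
  open ≡-Reasoning
  instance _ = ≢-nonZero q≢0

contr-charge-lower-bound : ∀ U W r s Cn SC → 0ℚ ≤ℚ W →
  U * U - s ≤ℚ Cn * W → Cn ≤ℚ SC → s ≤ℚ r * r →
  (W - U) * (W - U) + r * (W - r) ≤ℚ (SC - two * (U - ½ * (W + r))) * W
contr-charge-lower-bound U W r s Cn SC 0≤W contr-W Cn≤SC s≤r² =
  ≤-by-gap (+-nonNeg (+-nonNeg (*-nonNeg (p≤q⇒0≤q-p Cn≤SC) 0≤W) (p≤q⇒0≤q-p contr-W)) (p≤q⇒0≤q-p s≤r²))
    (solve 6 (λ U W r s Cn SC →
        (W :- U) :* (W :- U) :+ r :* (W :- r)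
          :+ ((SC :- Cn) :* W :+ (Cn :* W :- (U :* U :- s)) :+ (r :* r :- s))
      := (SC :- con two :* (U :- con ½ :* (W :+ r))) :* W) refl U W r s Cn SC)

small-rest-gap : ∀ ε ξ W r → 0ℚ ≤ℚ W → 0ℚ ≤ℚ r → ε + two * ξ ≤ℚ 1ℚ → r ≤ℚ ε * W →
  two * ξ * W * r ≤ℚ r * (W - r)
small-rest-gap ε ξ W r 0≤W 0≤r ε+2ξ≤1 r≤εW =
  ≤-by-gap (*-nonNeg 0≤r (+-nonNeg (*-nonNeg (p≤q⇒0≤q-p ε+2ξ≤1) 0≤W) (p≤q⇒0≤q-p r≤εW)))
    (solve 4 (λ ε ξ W r →
        con two :* ξ :* W :* r :+ r :* ((con 1ℚ :- (ε :+ con two :* ξ)) :* W :+ (ε :* W :- r))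
      := r :* (W :- r)) refl ε ξ W r)

square-ratio-bound : ∀ ε c U W s {a} → 0ℚ < 1ℚ - ε * ε → c * (1ℚ - ε * ε) ≡ a →
  U * U - s ≤ℚ a * (W * W) → s ≤ℚ (ε * U) * (ε * U) → U * U ≤ℚ c * (W * W)
square-ratio-bound ε c U W s 0<1-ε² refl U²-s≤aW² s≤ε²U² =
  *-cancelʳ-≤-pos (1ℚ - ε * ε) {{positive 0<1-ε²}}
    (≤-by-gap (+-nonNeg (p≤q⇒0≤q-p U²-s≤aW²) (p≤q⇒0≤q-p s≤ε²U²))
      (solve 5 (λ ε c U W s →
          U :* U :* (con 1ℚ :- ε :* ε)
            :+ ((c :* (con 1ℚ :- ε :* ε) :* (W :* W) :- (U :* U :- s)) :+ ((ε :* U) :* (ε :* U) :- s))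
        := c :* (W :* W) :* (con 1ℚ :- ε :* ε)) refl ε c U W s))

bounded-ratio-gap : ∀ ξ c U W → 0ℚ ≤ℚ ξ → two * ξ ≤ℚ 1ℚ → c ≤ℚ 1ℚ →
  four * c ≤ℚ (1ℚ + c - two * ξ) * (1ℚ + c - two * ξ) → U * U ≤ℚ c * (W * W) →
  two * ξ * (W * W) ≤ℚ (W - U) * (W - U)
bounded-ratio-gap ξ c U W 0≤ξ 2ξ≤1 c≤1 4c≤D² U²≤cW² =
  ≤-by-gap (p≤q⇒0≤q-p 2UW≤qW²+U²)
    (solve 4 (λ ξ U W c →
        con two :* ξ :* (W :* W) :+ (((con 1ℚ :- con two :* ξ) :* (W :* W) :+ U :* U) :- con two :* U :* W)
      := (W :- U) :* (W :- U)) refl ξ U W c)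
  where
  y = W * W
  0≤2 : 0ℚ ≤ℚ two
  0≤2 = nonNegative⁻¹ two
  0≤4 : 0ℚ ≤ℚ four
  0≤4 = nonNegative⁻¹ four
  -- (1 − √c)² ≥ 2ξ without square roots: compare the squares of both sides.
  2UW≤qW²+U² : two * U * W ≤ℚ (1ℚ - two * ξ) * y + U * U
  2UW≤qW²+U² = ≤-from-squares
    (+-nonNeg (*-nonNeg (p≤q⇒0≤q-p 2ξ≤1) (square-nonNeg W)) (square-nonNeg U))
    (≤-by-gap
      (+-nonNeg (*-nonNeg (square-nonNeg y) (p≤q⇒0≤q-p 4c≤D²))
                (*-nonNeg (p≤q⇒0≤q-p U²≤cW²)
                   (+-nonNeg (+-nonNeg (p≤q⇒0≤q-p U²≤cW²) (*-nonNeg (*-nonNeg 0≤2 (p≤q⇒0≤q-p c≤1)) (square-nonNeg W)))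
                             (*-nonNeg (*-nonNeg 0≤4 0≤ξ) (square-nonNeg W)))))
      (solve 4 (λ ξ U W c →
          con two :* U :* W :* (con two :* U :* W)
            :+ ((W :* W) :* (W :* W) :* ((con 1ℚ :+ c :- con two :* ξ) :* (con 1ℚ :+ c :- con two :* ξ) :- con four :* c)
                :+ (c :* (W :* W) :- U :* U)
                   :* ((c :* (W :* W) :- U :* U) :+ con two :* (con 1ℚ :- c) :* (W :* W) :+ con four :* ξ :* (W :* W)))
        := ((con 1ℚ :- con two :* ξ) :* (W :* W) :+ U :* U) :* ((con 1ℚ :- con two :* ξ) :* (W :* W) :+ U :* U)) refl ξ U W c))

radicand : ℚ → ℚ
radicand ε = (+ 5 / 8) ÷' (1ℚ - ε * ε)

module _ {ε ξ : ℚ} (K : Constants ε ξ) where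
  open Constants K

  ε+2ξ≤1 : ε + two * ξ ≤ℚ 1ℚ
  ε+2ξ≤1 = begin
    ε + two * ξ                       ≤⟨ +-monoʳ-≤ ε 2ξ≤1-2ε-2ε² ⟩
    ε + (1ℚ - two * ε * (1ℚ + ε))     ≤⟨ ≤-by-gap 0≤ε+2ε² (solve 1 (λ ε →
                                            ε :+ (con 1ℚ :- con two :* ε :* (con 1ℚ :+ ε)) :+ (ε :+ con two :* ε :* ε)
                                          := con 1ℚ) refl ε) ⟩
    1ℚ                                ∎
    where
    open ≤-Reasoning
    0≤ε = <⇒≤ ε-pos
    0≤ε+2ε² = +-nonNeg 0≤ε (*-nonNeg (*-nonNeg (nonNegative⁻¹ two) 0≤ε) 0≤ε)
    ρ = 1ℚ - two * ε * (1ℚ + ε)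
    2ξ≤1-2ε-2ε² : two * ξ ≤ℚ ρ
    2ξ≤1-2ε-2ε² = subst (two * ξ ≤ℚ_)
      (trans (*-comm two (ρ ÷' two)) (÷'-*-cancel (positive⁻¹ two)))
      (*-monoˡ-≤-nonNeg two c6)

  2ξ≤1 : two * ξ ≤ℚ 1ℚ
  2ξ≤1 = ≤-trans (≤-by-gap (<⇒≤ ε-pos) (+-comm (two * ξ) ε)) ε+2ξ≤1

  radicand-scale : radicand ε * (1ℚ - ε * ε) ≡ + 5 / 8
  radicand-scale = ÷'-*-cancel radicand-pos

  -- c3 forces ε² ≤ 1/4.
  radicand≤1 : radicand ε ≤ℚ 1ℚ
  radicand≤1 = *-cancelʳ-≤-pos (1ℚ - ε * ε) {{positive radicand-pos}}
    (subst₂ _≤ℚ_ (sym radicand-scale) (sym (*-identityˡ (1ℚ - ε * ε)))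
      (≤-by-gap (+-nonNeg (p≤q⇒0≤q-p c3)
                          (+-nonNeg (+-nonNeg (nonNegative⁻¹ (+ 1 / 8)) (*-nonNeg (nonNegative⁻¹ (+ 3 / 2)) 0≤ε))
                                    (*-nonNeg (nonNegative⁻¹ (+ 3 / 4)) (square-nonNeg ε))))
        (solve 1 (λ ε →
            con (+ 5 / 8) :+ ((con 1ℚ :- (con (+ 3 / 4) :* ((con 1ℚ :+ ε) :* (con 1ℚ :+ ε)) :+ ε :* ε))
                             :+ (con (+ 1 / 8) :+ con (+ 3 / 2) :* ε :+ con (+ 3 / 4) :* (ε :* ε)))
          := con 1ℚ :- ε :* ε) refl ε)))
    where 0≤ε = <⇒≤ ε-pos

  -- c7b is the root-free form of (1 − √c)²/(1 + ε√c) ≥ 2ξ; its weakening to denominator 1 suffices.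
  four*radicand≤D² : four * radicand ε ≤ℚ (1ℚ + radicand ε - two * ξ) * (1ℚ + radicand ε - two * ξ)
  four*radicand≤D² = ≤-trans
    (≤-by-gap (*-nonNeg (*-nonNeg 0≤2ξε (+-nonNeg (nonNegative⁻¹ four) 0≤2ξε)) 0≤c)
      (solve 3 (λ ξ ε c → con four :* c :+ con two :* ξ :* ε :* (con four :+ con two :* ξ :* ε) :* c
                       := (con two :+ con two :* ξ :* ε) :* (con two :+ con two :* ξ :* ε) :* c) refl ξ ε (radicand ε)))
    c7b
    where
    0≤2ξε = *-nonNeg (*-nonNeg (nonNegative⁻¹ two) (<⇒≤ ξ-pos)) (<⇒≤ ε-pos)
    0≤c : 0ℚ ≤ℚ radicand ε
    0≤c = *-cancelʳ-≤-pos (1ℚ - ε * ε) {{positive radicand-pos}}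
      (subst₂ _≤ℚ_ (sym (*-zeroˡ (1ℚ - ε * ε))) (sym radicand-scale) (nonNegative⁻¹ (+ 5 / 8)))

==-refl : ∀ {n} (i : Fin n) → (i == i) ≡ true
==-refl i = trans (isYes≗does (i ≟ᶠ i)) (dec-true (i ≟ᶠ i) refl)

==⇒≡ : ∀ {n} {i j : Fin n} → (i == j) ≡ true → i ≡ j
==⇒≡ i==j = toWitness (Equivalence.from T-≡ i==j)

suc==suc : ∀ {n} (i j : Fin n) → (suc i == suc j) ≡ (i == j)
suc==suc i j = ⌊⌋-map′ (cong suc) suc-injective (i ≟ᶠ j)

∨-true : ∀ {a b} → a ∨ b ≡ true → a ≡ true ⊎ b ≡ true
∨-true {true} _ = inj₁ refl
∨-true {false} b≡true = inj₂ b≡true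

foldr-allFin-suc : ∀ {n} {B : Set} (h : Fin (ℕ.suc n) → B → B) (z : B) →
  foldr h z (allFin (ℕ.suc n)) ≡ h zero (foldr (h ∘ suc) z (allFin n))
foldr-allFin-suc {n} h z = cong (h zero) (begin
  foldr h z (tabulate suc)          ≡⟨ cong (foldr h z) (map-tabulate id suc) ⟨
  foldr h z (map suc (allFin n))    ≡⟨ foldr-map h suc z (allFin n) ⟩
  foldr (h ∘ suc) z (allFin n)      ∎)
  where open ≡-Reasoning

∑-suc : ∀ {n} (f : Fin (ℕ.suc n) → ℚ) → ∑ f ≡ f zero + ∑ (f ∘ suc)
∑-suc f = foldr-allFin-suc (λ i acc → f i + acc) 0ℚ

∑≡sum : ∀ {n} (f : Fin n → ℚ) → ∑ f ≡ sum f
∑≡sum {ℕ.zero} f = refl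
∑≡sum {ℕ.suc n} f = trans (∑-suc f) (cong (_+_ (f zero)) (∑≡sum (f ∘ suc)))

∑-cong : ∀ {n} {f g : Fin n → ℚ} → (∀ i → f i ≡ g i) → ∑ f ≡ ∑ g
∑-cong {f = f} {g} f≗g = begin
  ∑ f    ≡⟨ ∑≡sum f ⟩
  sum f  ≡⟨ Σ.sum-cong-≗ f≗g ⟩
  sum g  ≡⟨ ∑≡sum g ⟨
  ∑ g    ∎
  where open ≡-Reasoning

∑-zero : ∀ n → ∑ {n} (λ _ → 0ℚ) ≡ 0ℚ
∑-zero n = trans (∑≡sum {n} (λ _ → 0ℚ)) (Σ.sum-replicate-zero n)

∑-distrib-+ : ∀ {n} (f g : Fin n → ℚ) → ∑ (λ i → f i + g i) ≡ ∑ f + ∑ g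
∑-distrib-+ f g = begin
  ∑ (λ i → f i + g i)    ≡⟨ ∑≡sum (λ i → f i + g i) ⟩
  sum (λ i → f i + g i)  ≡⟨ Σ.∑-distrib-+ f g ⟩
  sum f + sum g          ≡⟨ cong₂ _+_ (∑≡sum f) (∑≡sum g) ⟨
  ∑ f + ∑ g              ∎
  where open ≡-Reasoning

∑-indicator : ∀ {n} (m : Fin n) (c : ℚ) → ∑ (λ i → if i == m then c else 0ℚ) ≡ c
∑-indicator {ℕ.suc n} zero c = trans (∑-suc {n} (λ i → if i == zero then c else 0ℚ)) $ begin
  c + ∑ {n} (λ _ → 0ℚ)  ≡⟨ cong (_+_ c) (∑-zero n) ⟩
  c + 0ℚ                ≡⟨ +-identityʳ c ⟩
  c                     ∎
  where open ≡-Reasoning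
∑-indicator {ℕ.suc n} (suc m) c = trans (∑-suc {n} (λ i → if i == suc m then c else 0ℚ)) $ begin
  0ℚ + ∑ (λ i → if suc i == suc m then c else 0ℚ)  ≡⟨ +-identityˡ _ ⟩
  ∑ (λ i → if suc i == suc m then c else 0ℚ)       ≡⟨ ∑-cong (λ i → cong (λ b → if b then c else 0ℚ) (suc==suc i m)) ⟩
  ∑ (λ i → if i == m then c else 0ℚ)               ≡⟨ ∑-indicator m c ⟩
  c                                                ∎
  where open ≡-Reasoning

∑-mono : ∀ {n} {f g : Fin n → ℚ} → (∀ i → f i ≤ℚ g i) → ∑ f ≤ℚ ∑ g
∑-mono {ℕ.zero} _ = ≤-refl
∑-mono {ℕ.suc n} {f} {g} f≤g rewrite ∑-suc f | ∑-suc g = +-mono-≤ (f≤g zero) (∑-mono (f≤g ∘ suc))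

∑-nonNeg : ∀ {n} {f : Fin n → ℚ} → (∀ i → 0ℚ ≤ℚ f i) → 0ℚ ≤ℚ ∑ f
∑-nonNeg {ℕ.zero} _ = ≤-refl
∑-nonNeg {ℕ.suc n} {f} 0≤f rewrite ∑-suc f = +-nonNeg (0≤f zero) (∑-nonNeg (0≤f ∘ suc))

term≤∑ : ∀ {n} {f : Fin n → ℚ} → (∀ i → 0ℚ ≤ℚ f i) → ∀ m → f m ≤ℚ ∑ f
term≤∑ {ℕ.suc n} {f} 0≤f zero rewrite ∑-suc f = ≤-by-gap (∑-nonNeg (0≤f ∘ suc)) refl
term≤∑ {ℕ.suc n} {f} 0≤f (suc m) rewrite ∑-suc f =
  subst (_≤ℚ _) (+-identityˡ (f (suc m))) (+-mono-≤ (0≤f zero) (term≤∑ (0≤f ∘ suc) m))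

∑-square≤square-∑ : ∀ {n} {f : Fin n → ℚ} → (∀ i → 0ℚ ≤ℚ f i) → ∑ (λ i → f i * f i) ≤ℚ ∑ f * ∑ f
∑-square≤square-∑ {ℕ.zero} _ = ≤-refl
∑-square≤square-∑ {ℕ.suc n} {f} 0≤f rewrite ∑-suc (λ i → f i * f i) | ∑-suc f = begin
  a * a + ∑ (λ i → f (suc i) * f (suc i))  ≤⟨ +-monoʳ-≤ (a * a) (∑-square≤square-∑ (0≤f ∘ suc)) ⟩
  a * a + t * t                            ≤⟨ ≤-by-gap (*-nonNeg (*-nonNeg (nonNegative⁻¹ two) (0≤f zero)) (∑-nonNeg (0≤f ∘ suc)))
                                                (solve 2 (λ a t → a :* a :+ t :* t :+ con two :* a :* t := (a :+ t) :* (a :+ t)) refl a t) ⟩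
  (a + t) * (a + t)                        ∎
  where
  open ≤-Reasoning
  a = f zero
  t = ∑ (f ∘ suc)

infix 9 ∑⟨_⟩_

∑⟨_⟩_ : ∀ {n} → Sub n → (Fin n → ℚ) → ℚ
∑⟨ S ⟩ f = ∑ λ i → if S i then f i else 0ℚ

if-split : ∀ (s d : Bool) {x y : ℚ} → (d ≡ true → s ≡ true) → (d ≡ true → x ≡ y) →
  (if s then x else 0ℚ) ≡ (if d then y else 0ℚ) + (if s ∧ not d then x else 0ℚ)
if-split true true {x} {y} _ x≡y = trans (x≡y refl) (sym (+-identityʳ y))
if-split true false {x} _ _ = sym (+-identityˡ x)
if-split false true d⇒s _ with d⇒s refl
... | ()
if-split false false _ _ = sym (+-identityˡ 0ℚ)

∑⟨⟩-remove : ∀ {n} (f : Fin n → ℚ) (S : Sub n) {m : Fin n} → m ∈ˢ S →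
  ∑⟨ S ⟩ f ≡ f m + ∑⟨ (λ i → S i ∧ not (i == m)) ⟩ f
∑⟨⟩-remove f S {m} m∈S = begin
  ∑⟨ S ⟩ f
    ≡⟨ ∑-cong (λ i → if-split (S i) (i == m) (λ i==m → subst (_∈ˢ S) (sym (==⇒≡ i==m)) m∈S)
                                             (λ i==m → cong f (==⇒≡ i==m))) ⟩
  ∑ (λ i → (if i == m then f m else 0ℚ) + (if S i ∧ not (i == m) then f i else 0ℚ))
    ≡⟨ ∑-distrib-+ (λ i → if i == m then f m else 0ℚ) (λ i → if S i ∧ not (i == m) then f i else 0ℚ) ⟩
  ∑ (λ i → if i == m then f m else 0ℚ) + ∑⟨ (λ i → S i ∧ not (i == m)) ⟩ f
    ≡⟨ cong (_+ ∑⟨ (λ i → S i ∧ not (i == m)) ⟩ f) (∑-indicator m (f m)) ⟩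
  f m + ∑⟨ (λ i → S i ∧ not (i == m)) ⟩ f
    ∎
  where open ≡-Reasoning

∑⟨⟩-empty : ∀ {n} (f : Fin n → ℚ) {S : Sub n} → (∀ i → S i ≡ false) → ∑⟨ S ⟩ f ≡ 0ℚ
∑⟨⟩-empty {n} f S≡∅ = trans (∑-cong (λ i → cong (λ b → if b then f i else 0ℚ) (S≡∅ i))) (∑-zero n)

module _ {n} {f : Fin n → ℚ} (0≤f : ∀ i → 0ℚ ≤ℚ f i) where

  if-nonNeg : ∀ b i → 0ℚ ≤ℚ (if b then f i else 0ℚ)
  if-nonNeg true i = 0≤f i
  if-nonNeg false i = ≤-refl

  ∑⟨⟩-nonNeg : ∀ S → 0ℚ ≤ℚ ∑⟨ S ⟩ f
  ∑⟨⟩-nonNeg S = ∑-nonNeg (λ i → if-nonNeg (S i) i)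

  ∑⟨⟩-mono-⊆ : ∀ {S T : Sub n} → (∀ i → i ∈ˢ S → i ∈ˢ T) → ∑⟨ S ⟩ f ≤ℚ ∑⟨ T ⟩ f
  ∑⟨⟩-mono-⊆ {S} {T} S⊆T = ∑-mono (λ i → pointwise (S i) (T i) (S⊆T i) i)
    where
    pointwise : ∀ s t → (s ≡ true → t ≡ true) → ∀ i → (if s then f i else 0ℚ) ≤ℚ (if t then f i else 0ℚ)
    pointwise true t s⇒t i rewrite s⇒t refl = ≤-refl
    pointwise false t _ i = if-nonNeg t i

  ∈⇒≤∑⟨⟩ : ∀ (S : Sub n) {m} → m ∈ˢ S → f m ≤ℚ ∑⟨ S ⟩ f
  ∈⇒≤∑⟨⟩ S {m} m∈S = subst (λ b → (if b then f m else 0ℚ) ≤ℚ ∑⟨ S ⟩ f) m∈S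
    (term≤∑ (λ i → if-nonNeg (S i) i) m)

  ∑⟨⟩-square≤square : ∀ (S : Sub n) → ∑⟨ S ⟩ (λ i → f i * f i) ≤ℚ ∑⟨ S ⟩ f * ∑⟨ S ⟩ f
  ∑⟨⟩-square≤square S = subst (_≤ℚ ∑⟨ S ⟩ f * ∑⟨ S ⟩ f) (∑-cong (λ i → square-if (S i) (f i)))
    (∑-square≤square-∑ (λ i → if-nonNeg (S i) i))
    where
    square-if : ∀ b x → (if b then x else 0ℚ) * (if b then x else 0ℚ) ≡ (if b then x * x else 0ℚ)
    square-if true x = refl
    square-if false x = *-zeroˡ 0ℚ

anyV-false : ∀ {n} (p : Fin n → Bool) → anyV p ≡ false → ∀ i → p i ≡ false
anyV-false {ℕ.suc n} p none zero = ∨-conicalˡ (p zero) _ (trans (sym (foldr-allFin-suc (λ i acc → p i ∨ acc) false)) none)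
anyV-false {ℕ.suc n} p none (suc i) =
  anyV-false (p ∘ suc) (∨-conicalʳ (p zero) _ (trans (sym (foldr-allFin-suc (λ i acc → p i ∨ acc) false)) none)) i

card-suc : ∀ {n} (S : Sub (ℕ.suc n)) → card S ≡ (if S zero then ℕ.suc (card (S ∘ suc)) else card (S ∘ suc))
card-suc S = foldr-allFin-suc (λ i acc → if S i then ℕ.suc acc else acc) 0

card-cong : ∀ {n} {S T : Sub n} → (∀ i → S i ≡ T i) → card S ≡ card T
card-cong {ℕ.zero} _ = refl
card-cong {ℕ.suc n} {S} {T} S≗T
  rewrite card-suc S | card-suc T | S≗T zero | card-cong {S = S ∘ suc} {T ∘ suc} (S≗T ∘ suc) = refl

card-∅ : ∀ n → card {n} (λ _ → false) ≡ 0
card-∅ ℕ.zero = refl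
card-∅ (ℕ.suc n) = trans (card-suc {n} (λ _ → false)) (card-∅ n)

card-singleton : ∀ {n} (u : Fin n) → card (λ v → v == u) ≡ 1
card-singleton {ℕ.suc n} zero = trans (card-suc {n} (λ v → v == zero)) (cong ℕ.suc (card-∅ n))
card-singleton {ℕ.suc n} (suc u) =
  trans (card-suc (λ v → v == suc u)) (trans (card-cong (λ i → suc==suc i u)) (card-singleton u))

module Weighted {n : ℕ} (G : SimpleGraph n) (w : Fin n → ℚ) (0<w : ∀ v → 0ℚ < w v) where
  open SimpleGraph G using (adj; irrefl)
  open Graph G w

  0≤w : ∀ v → 0ℚ ≤ℚ w v
  0≤w = <⇒≤ ∘ 0<w

  nbr∈A : ∀ {A} u {v} → v ∈ˢ Nv u A → v ∈ˢ A
  nbr∈A {A} u {v} = ∧-conicalˡ (A v) (singleton u v ∨ anyV (λ x → singleton u x ∧ adj v x))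

  singleton-independent : ∀ u → Independent (singleton u)
  singleton-independent u i j i∈ j∈ rewrite ==⇒≡ i∈ | ==⇒≡ j∈ = irrefl u

  nbr-nonempty : ∀ {A} → NoClawShapedImprovement A → ∀ u → anyV (Nv u A) ≡ true
  nbr-nonempty {A} noClaw u with anyV (Nv u A) in none
  ... | true = refl
  ... | false = ⊥-elim (noClaw (singleton u) (inj₁ (card-singleton u , anyV-false (Nv u A) none))
                                             (singleton-independent u , improvement))
    where
    0<w² : 0ℚ < w u * w u
    0<w² = positive⁻¹ (w u * w u) {{pos*pos⇒pos (w u) {{positive (0<w u)}} (w u) {{positive (0<w u)}}}}
    improvement : wt² (Nv u A) < wt² (singleton u)
    improvement = begin-strict
      wt² (Nv u A)       ≡⟨ ∑⟨⟩-empty (λ i → w i ²) (anyV-false (Nv u A) none) ⟩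
      0ℚ                 <⟨ 0<w² ⟩
      w u * w u          ≤⟨ ∈⇒≤∑⟨⟩ (λ i → square-nonNeg (w i)) (singleton u) (==-refl u) ⟩
      wt² (singleton u)  ∎
      where open ≤-Reasoning

  module Charges (A : Sub n) (nf nf₂ : Fin n → Fin n) (ε : ℚ) where
    open Charging A nf nf₂ ε

    contr-nonNeg : ∀ u v → 0ℚ ≤ℚ contr u v
    contr-nonNeg u v with Nv u A v
    ... | true = p≤p⊔q 0ℚ (((w u) ² - wt² (Nv u A ∖₁ v)) ÷' w v)
    ... | false = ≤-refl

    contr≤sumContr : ∀ u {v} → v ∈ˢ A → contr u v ≤ℚ sumContr u
    contr≤sumContr u = ∈⇒≤∑⟨⟩ (contr-nonNeg u) A

    contr-lower-bound : ∀ u {v} → v ∈ˢ Nv u A → w u * w u - wt² (Nv u A ∖₁ v) ≤ℚ contr u v * w v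
    contr-lower-bound u {v} v∈N = begin
      w u * w u - wt² (Nv u A ∖₁ v)  ≡⟨ ÷'-*-cancel (0<w v) ⟨
      x * w v                        ≤⟨ *-monoʳ-≤-nonNeg (w v) {{nonNegative (0≤w v)}} (p≤q⊔p 0ℚ x) ⟩
      (0ℚ ⊔ x) * w v                 ≡⟨ cong (λ b → (if b then 0ℚ ⊔ x else 0ℚ) * w v) v∈N ⟨
      contr u v * w v                ∎
      where
      open ≤-Reasoning
      x = ((w u) ² - wt² (Nv u A ∖₁ v)) ÷' w v

    charge-at-max : ∀ u → nf u ∈ˢ Nv u A → charge u (nf u) ≡ w u - ½ * (w (nf u) + wt (Nv u A ∖₁ nf u))
    charge-at-max u m∈N rewrite ==-refl (nf u) = cong (λ t → w u - ½ * t) (∑⟨⟩-remove w (Nv u A) m∈N)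

    helpful⇒bounded : ∀ u v → help u v ≡ true → w (nf u) ≤ℚ (1ℚ + ε) * w u
    helpful⇒bounded u v h = ≤ᵇ-true⇒≤ (bound (∨-true (∧-conicalʳ (inNbrOutside u v) hA∨hB
                                                      (∧-conicalʳ (A v) (inNbrOutside u v ∧ hA∨hB) h))))
      where
      hA∨hB = helpfulA u v ∨ helpfulB u v
      B = w (nf u) ≤ᵇ (1ℚ + ε) * w u
      bound : helpfulA u v ≡ true ⊎ helpfulB u v ≡ true → B ≡ true
      bound (inj₁ a) = ∧-conicalˡ B _ (∧-conicalʳ (v == nf u) _ a)
      bound (inj₂ b) = ∧-conicalˡ B _
        (∧-conicalʳ (w (nf₂ u) ≤ᵇ w (nf u)) _
        (∧-conicalʳ (w (nf u) ÷' (1ℚ + ε) ≤ᵇ w (nf₂ u)) _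
        (∧-conicalʳ ((v == nf u) ∨ (v == nf₂ u)) _
        (∧-conicalʳ ⌊ 2 ℕ.≤? card (Nv u A) ⌋ _ b))))

    heavy⇒unhelpful : ∀ u → (1ℚ + ε) * w u < w (nf u) → ∀ v → help u v ≡ false
    heavy⇒unhelpful u heavy v = ¬-not λ h → <-irrefl refl (<-≤-trans heavy (helpful⇒bounded u v h))

    supp⇒∈N : ∀ u i → i ∈ˢ supp u → i ∈ˢ Nv u A
    supp⇒∈N u i = ∧-conicalˡ (Nv u A i) (not (help u i) ∧ not (special u i))

    supp⇒unspecial : ∀ u i → i ∈ˢ supp u → not (special u i) ≡ true
    supp⇒unspecial u i i∈supp =
      ∧-conicalʳ (not (help u i)) (not (special u i)) (∧-conicalʳ (Nv u A i) (not (help u i) ∧ not (special u i)) i∈supp)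

    special⇒supp⊆rest : ∀ u → special u (nf u) ≡ true → ∀ i → i ∈ˢ supp u → i ∈ˢ (Nv u A ∖₁ nf u)
    special⇒supp⊆rest u sp i i∈supp = begin
      Nv u A i ∧ not (i == nf u)  ≡⟨ cong (λ b → Nv u A i ∧ not b) i==m ⟩
      Nv u A i ∧ true             ≡⟨ ∧-identityʳ (Nv u A i) ⟩
      Nv u A i                    ≡⟨ supp⇒∈N u i i∈supp ⟩
      true                        ∎
      where
      open ≡-Reasoning
      i≢m : i ≢ nf u
      i≢m i≡m = case trans (sym (cong not sp)) (subst (λ j → not (special u j) ≡ true) i≡m (supp⇒unspecial u i i∈supp))
                of λ ()
      i==m : (i == nf u) ≡ false
      i==m = trans (isYes≗does (i ≟ᶠ nf u)) (dec-false (i ≟ᶠ nf u) i≢m)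

    unspecial⇒contr-bound : ∀ u → help u (nf u) ≡ false → special u (nf u) ≡ false →
      contr u (nf u) ≤ℚ (+ 5 / 8) * w (nf u)
    unspecial⇒contr-bound u unhelpful unspecial = ≤ᵇ-true⇒≤ (not-injective (trans (sym special≡not) unspecial))
      where
      special≡not : special u (nf u) ≡ not (contr u (nf u) ≤ᵇ (+ 5 / 8) * w (nf u))
      special≡not = cong₂ (λ x h → x ∧ not h ∧ not (contr u (nf u) ≤ᵇ (+ 5 / 8) * w (nf u))) (==-refl (nf u)) unhelpful

    module HeavyMaxNeighbour {ξ} (K : Constants ε ξ) (u : Fin n) (m∈N : nf u ∈ˢ Nv u A)
                             (r≤εU : wt (Nv u A ∖₁ nf u) ≤ℚ ε * w u)
                             (heavy : (1ℚ + ε) * w u < w (nf u)) where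
      U W r s : ℚ
      U = w u
      W = w (nf u)
      r = wt (Nv u A ∖₁ nf u)
      s = wt² (Nv u A ∖₁ nf u)

      private
        0≤W = 0≤w (nf u)
        0≤r = ∑⟨⟩-nonNeg 0≤w (Nv u A ∖₁ nf u)
        0≤ε = <⇒≤ (Constants.ε-pos K)
        0≤2ξW = *-nonNeg (*-nonNeg (nonNegative⁻¹ two) (<⇒≤ (Constants.ξ-pos K))) 0≤W

        U≤W : U ≤ℚ W
        U≤W = <⇒≤ (≤-<-trans (≤-by-gap (*-nonNeg 0≤ε (0≤w u))
                                       (solve 2 (λ ε U → U :+ ε :* U := (con 1ℚ :+ ε) :* U) refl ε U))
                             heavy)

        r≤εW : r ≤ℚ ε * W
        r≤εW = ≤-trans r≤εU (*-monoˡ-≤-nonNeg ε {{nonNegative 0≤ε}} U≤W)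

      s≤r² : s ≤ℚ r * r
      s≤r² = ∑⟨⟩-square≤square 0≤w (Nv u A ∖₁ nf u)

      unspecial⇒U²≤cW² : special u (nf u) ≡ false → U * U ≤ℚ radicand ε * (W * W)
      unspecial⇒U²≤cW² sp =
        square-ratio-bound ε (radicand ε) U W s (Constants.radicand-pos K) (radicand-scale K) U²-s≤5/8W²
          (≤-trans s≤r² (square-mono {p = r} {ε * U} 0≤r r≤εU))
        where
        open ≤-Reasoning
        U²-s≤5/8W² : U * U - s ≤ℚ (+ 5 / 8) * (W * W)
        U²-s≤5/8W² = begin
          U * U - s             ≤⟨ contr-lower-bound u m∈N ⟩
          contr u (nf u) * W    ≤⟨ *-monoʳ-≤-nonNeg W {{nonNegative 0≤W}}
                                     (unspecial⇒contr-bound u (heavy⇒unhelpful u heavy (nf u)) sp) ⟩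
          (+ 5 / 8) * W * W     ≡⟨ *-assoc (+ 5 / 8) W W ⟩
          (+ 5 / 8) * (W * W)   ∎

      supp-weight-gap : two * ξ * W * wt (supp u) ≤ℚ (W - U) * (W - U) + r * (W - r)
      supp-weight-gap with special u (nf u) in sp
      ... | true = begin
        two * ξ * W * wt (supp u)        ≤⟨ *-monoˡ-≤-nonNeg (two * ξ * W) {{nonNegative 0≤2ξW}}
                                              (∑⟨⟩-mono-⊆ 0≤w (special⇒supp⊆rest u sp)) ⟩
        two * ξ * W * r                  ≤⟨ small-rest-gap ε ξ W r 0≤W 0≤r (ε+2ξ≤1 K) r≤εW ⟩
        r * (W - r)                      ≤⟨ ≤-by-gap (square-nonNeg (W - U)) (+-comm (r * (W - r)) _) ⟩
        (W - U) * (W - U) + r * (W - r)  ∎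
        where open ≤-Reasoning
      ... | false = begin
        two * ξ * W * wt (supp u)            ≤⟨ *-monoˡ-≤-nonNeg (two * ξ * W) {{nonNegative 0≤2ξW}}
                                                  (∑⟨⟩-mono-⊆ 0≤w (supp⇒∈N u)) ⟩
        two * ξ * W * wt (Nv u A)            ≡⟨ cong (two * ξ * W *_) (∑⟨⟩-remove w (Nv u A) m∈N) ⟩
        two * ξ * W * (W + r)                ≡⟨ solve 3 (λ ξ W r → con two :* ξ :* W :* (W :+ r)
                                                  := con two :* ξ :* (W :* W) :+ con two :* ξ :* W :* r) refl ξ W r ⟩
        two * ξ * (W * W) + two * ξ * W * r  ≤⟨ +-mono-≤ W-U-gap (small-rest-gap ε ξ W r 0≤W 0≤r (ε+2ξ≤1 K) r≤εW) ⟩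
        (W - U) * (W - U) + r * (W - r)      ∎
        where
        open ≤-Reasoning
        W-U-gap : two * ξ * (W * W) ≤ℚ (W - U) * (W - U)
        W-U-gap = bounded-ratio-gap ξ (radicand ε) U W (<⇒≤ (Constants.ξ-pos K)) (2ξ≤1 K) (radicand≤1 K)
                    (four*radicand≤D² K) (unspecial⇒U²≤cW² sp)

lemma8 : (k : ℕ) → 4 ≤ k → (ε ξ : ℚ) → Constants ε ξ →
    (n : ℕ) (G : SimpleGraph n) → ClawFree k G →
    (w : Fin n → ℚ) → (∀ v → 0ℚ < w v) →
    (A* A : Sub n) →
    Graph.MaxWeightIndependent G w A* →
    Graph.Independent G w A →
    Graph.NoClawShapedImprovement G w A →
    (nf nf₂ : Fin n → Fin n) →
    Graph.IsMaxNbr G w A nf →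
    Graph.IsSecondMaxNbr G w A nf nf₂ →
    (u : Fin n) → u ∈ˢ A* →
    Graph.wt G w (Graph._∖₁_ G w (Graph.Nv G w u A) (nf u)) ≤ℚ ε * w u →
    (1ℚ + ε) * w u < w (nf u) →
    (+ 2 / 1) * ξ * w (nf u) * Graph.wt G w (Graph.Charging.supp G w A nf nf₂ ε u)
      ≤ℚ (Graph.Charging.sumContr G w A nf nf₂ ε u
            - (+ 2 / 1) * Graph.Charging.charge G w A nf nf₂ ε u (nf u)) * w (nf u)
lemma8 _ _ ε ξ K n G _ w 0<w _ A _ _ noClaw nf nf₂ isMax _ u _ r≤εU heavy = begin
  two * ξ * W * wt (supp u)                    ≤⟨ supp-weight-gap ⟩
  (W - U) * (W - U) + r * (W - r)              ≤⟨ contr-charge-lower-bound U W r s (contr u (nf u)) (sumContr u) (0≤w (nf u))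
                                                    (contr-lower-bound u m∈N) (contr≤sumContr u (nbr∈A {A} u m∈N)) s≤r² ⟩
  (sumContr u - two * (U - ½ * (W + r))) * W   ≡⟨ cong (λ c → (sumContr u - two * c) * W) (charge-at-max u m∈N) ⟨
  (sumContr u - two * charge u (nf u)) * W     ∎
  where
  open ≤-Reasoning
  open Graph G w
  open Charging A nf nf₂ ε
  open Weighted G w 0<w
  open Charges A nf nf₂ ε
  m∈N : nf u ∈ˢ Nv u A
  m∈N = proj₁ (isMax u (nbr-nonempty noClaw u))
  open HeavyMaxNeighbour K u m∈N r≤εU heavy
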